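{- Let $H$ be a reflexive digraph, $K$ the complete graph on $V(H)$, and $T$ an orientation of $K$ consistent with $H$. Suppose $u,v,w$ are vertices with $u \to v$, $v \to w$, and $w \to u$ in $T$. If $v', w'$ are vertices with $v' \to w'$ in $T$ and $(v',w') \to (v,w)$ in $H^*$, then $u \to v'$, $v' \to w'$, and $w' \to u$ in $T$.
   Context: Digraphs are finite, without multiple edges, possibly with loops; reflexive means every vertex has a loop. The implication graph $H^*$ of $H$ has vertex set $\{(x,y) : x,y\in V(H),\ x \neq y\}$, and for any three distinct vertices $x,y,z$ of $H$ we have edges $(x,y) \to (z,y)$ and $(y,z) \to (y,x)$ in $H^*$ if and only if either ($(x,z) \in E(H)$ and $(x,y) \notin E(H)$) or ($(z,x) \in E(H)$ and $(y,x) \notin E(H)$). A vertex $(x,y)$ of $H^*$ is an implicant of $(x',y')$ if $H^*$ has a directed walk from $(x',y')$ to $(x,y)$. An orientation of $K$ replaces each edge $xy$ by exactly one of $(x,y),(y,x)$; $x \to y$ in $T$ means $(x,y) \in E(T)$. $T$ is consistent with $H$ if for every vertex $(x,y)$ of $H^*$, $x \to y$ in $T$ implies $x' \to y'$ in $T$ for every implicant $(x',y')$ of $(x,y)$. -}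

module Defs where

open import Data.Nat using (ℕ)
open import Data.Fin using (Fin)
open import Data.Bool using (Bool; true; false)
open import Data.Product using (_×_; _,_)
open import Data.Sum using (_⊎_)
open import Relation.Nullary using (¬_)
open import Relation.Binary.PropositionalEquality using (_≡_; _≢_)
open import Relation.Binary.Construct.Closure.ReflexiveTransitive using (Star)

record Digraph (n : ℕ) : Set where
  field
    adj : Fin n → Fin n → Bool

open Digraph public

Edge : ∀ {n} → Digraph n → Fin n → Fin n → Set
Edge H x y = adj H x y ≡ true

Reflexive : ∀ {n} → Digraph n → Set
Reflexive H = ∀ x → Edge H x x

ImpCond : ∀ {n} → Digraph n → Fin n → Fin n → Fin n → Set
ImpCond H x y z = (Edge H x z × ¬ Edge H x y) ⊎ (Edge H z x × ¬ Edge H y x)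

-- Edges of the implication graph H*; its vertices are pairs (x , y) with x ≢ y.
-- For distinct x, y, z: (x,y) → (z,y) and (y,z) → (y,x) iff ImpCond H x y z.
data StarEdge {n} (H : Digraph n) : Fin n × Fin n → Fin n × Fin n → Set where
  edge₁ : ∀ {x y z} → x ≢ y → y ≢ z → x ≢ z → ImpCond H x y z →
          StarEdge H (x , y) (z , y)
  edge₂ : ∀ {x y z} → x ≢ y → y ≢ z → x ≢ z → ImpCond H x y z →
          StarEdge H (y , z) (y , x)

-- (x , y) is an implicant of (x' , y'): a directed walk in H* from (x',y') to (x,y).
Implicant : ∀ {n} → Digraph n → Fin n × Fin n → Fin n × Fin n → Set
Implicant H p q = Star (StarEdge H) q p

record Orientation (n : ℕ) : Set where
  field
    arc     : Fin n → Fin n → Bool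
    noLoop  : ∀ x → arc x x ≡ false
    total   : ∀ x y → x ≢ y → arc x y ≡ true ⊎ arc y x ≡ true
    antisym : ∀ x y → arc x y ≡ true → arc y x ≡ false

open Orientation public

_⟶[_]_ : ∀ {n} → Fin n → Orientation n → Fin n → Set
x ⟶[ T ] y = arc T x y ≡ true

Consistent : ∀ {n} → Digraph n → Orientation n → Set
Consistent H T = ∀ x y → x ≢ y → x ⟶[ T ] y →
  ∀ x' y' → Implicant H (x' , y') (x , y) → x' ⟶[ T ] y'

-- The argument uses two elementary facts about the condition ImpCond H x y z
-- ("x sees z but not y, in one of the two directions"), valid in any digraph:
--   * splitting: for every t, ImpCond H x y z gives ImpCond H x y t or
--     ImpCond H x t z (decide whether x sees t);
--   * reversed triangle: ImpCond H w v u forces one of the cyclic conditions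
--     ImpCond H u v w, ImpCond H v w u, ImpCond H w u v.
-- and two consequences of consistency: an H*-edge (x,y) → (z,y) propagates
-- x → y to z → y, hence ImpCond H x y z is impossible along a directed path
-- x → y → z.  The two kinds of H*-edges into (v , w) are then handled by
-- splitting the defining condition at u.
module Submission where

open import Defs
open import Data.Fin using (Fin)
open import Data.Product using (_×_; _,_)
open import Data.Bool using (true)
open import Data.Bool.Properties using () renaming (_≟_ to _≟ᵇ_)
open import Data.Sum using (_⊎_; inj₁; inj₂)
open import Data.Empty using (⊥; ⊥-elim)
open import Relation.Nullary using (¬_; yes; no)
open import Relation.Binary.PropositionalEquality using (_≢_; refl; sym; trans)
open import Relation.Binary.Construct.Closure.ReflexiveTransitive using (ε; _◅_)

module _ {n} (H : Digraph n) where

  edge? : ∀ x y → Edge H x y ⊎ ¬ Edge H x y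
  edge? x y with adj H x y ≟ᵇ true
  ... | yes e = inj₁ e
  ... | no ¬e = inj₂ ¬e

  imp-split : ∀ {x y z} t → ImpCond H x y z → ImpCond H x y t ⊎ ImpCond H x t z
  imp-split {x} t (inj₁ (xz , ¬xy)) with edge? x t
  ... | inj₁ xt  = inj₁ (inj₁ (xt , ¬xy))
  ... | inj₂ ¬xt = inj₂ (inj₁ (xz , ¬xt))
  imp-split {x} t (inj₂ (zx , ¬yx)) with edge? t x
  ... | inj₁ tx  = inj₁ (inj₂ (tx , ¬yx))
  ... | inj₂ ¬tx = inj₂ (inj₂ (zx , ¬tx))

  imp-reversed-triangle : ∀ {u v w} → ImpCond H w v u →
    ImpCond H u v w ⊎ ImpCond H v w u ⊎ ImpCond H w u v
  imp-reversed-triangle {u} {v} {w} (inj₁ (wu , ¬wv))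
    with edge? v u | edge? v w | edge? u v | edge? u w
  ... | inj₂ ¬vu | _        | _        | _        = inj₁ (inj₂ (wu , ¬vu))
  ... | inj₁ vu  | inj₂ ¬vw | _        | _        = inj₂ (inj₁ (inj₁ (vu , ¬vw)))
  ... | inj₁ _   | inj₁ _   | inj₁ uv  | _        = inj₂ (inj₁ (inj₂ (uv , ¬wv)))
  ... | inj₁ _   | inj₁ vw  | inj₂ _   | inj₂ ¬uw = inj₂ (inj₂ (inj₂ (vw , ¬uw)))
  ... | inj₁ _   | inj₁ _   | inj₂ ¬uv | inj₁ uw  = inj₁ (inj₁ (uw , ¬uv))
  imp-reversed-triangle {u} {v} {w} (inj₂ (uw , ¬vw))
    with edge? u v | edge? w v | edge? v u | edge? w u
  ... | inj₂ ¬uv | _        | _        | _        = inj₁ (inj₁ (uw , ¬uv))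
  ... | inj₁ uv  | inj₂ ¬wv | _        | _        = inj₂ (inj₁ (inj₂ (uv , ¬wv)))
  ... | inj₁ _   | inj₁ _   | inj₁ vu  | _        = inj₂ (inj₁ (inj₁ (vu , ¬vw)))
  ... | inj₁ _   | inj₁ wv  | inj₂ _   | inj₂ ¬wu = inj₂ (inj₂ (inj₁ (wv , ¬wu)))
  ... | inj₁ _   | inj₁ _   | inj₂ ¬vu | inj₁ wu  = inj₁ (inj₂ (wu , ¬vu))

module _ {n} (T : Orientation n) where

  arc-irrefl : ∀ {x y} → x ⟶[ T ] y → x ≢ y
  arc-irrefl {x} xy refl with trans (sym (noLoop T x)) xy
  ... | ()

  arc-asym : ∀ {x y} → x ⟶[ T ] y → y ⟶[ T ] x → ⊥
  arc-asym {x} {y} xy yx with trans (sym (antisym T x y xy)) yx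
  ... | ()

module Consistency {n} (H : Digraph n) (T : Orientation n) (consistent : Consistent H T) where

  propagate : ∀ {x y z} → y ≢ z → x ≢ z → ImpCond H x y z →
              x ⟶[ T ] y → z ⟶[ T ] y
  propagate {x} {y} {z} y≢z x≢z cond xy =
    consistent x y (arc-irrefl T xy) xy z y (edge₁ (arc-irrefl T xy) y≢z x≢z cond ◅ ε)

  -- The condition cannot hold along a directed path x → y → z of T:
  -- it would propagate x → y to z → y.
  imp-path-absurd : ∀ {x y z} → x ≢ z → ImpCond H x y z →
                    x ⟶[ T ] y → y ⟶[ T ] z → ⊥
  imp-path-absurd x≢z cond xy yz =
    arc-asym T yz (propagate (arc-irrefl T yz) x≢z cond xy)

  triangle-no-reversed-imp : ∀ {u v w} → u ⟶[ T ] v → v ⟶[ T ] w → w ⟶[ T ] u →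
                             ¬ ImpCond H w v u
  triangle-no-reversed-imp uv vw wu cond with imp-reversed-triangle H cond
  ... | inj₁ c        = imp-path-absurd (λ u≡w → arc-irrefl T wu (sym u≡w)) c uv vw
  ... | inj₂ (inj₁ c) = imp-path-absurd (λ v≡u → arc-irrefl T uv (sym v≡u)) c vw wu
  ... | inj₂ (inj₂ c) = imp-path-absurd (λ w≡v → arc-irrefl T vw (sym w≡v)) c wu uv

lemma3 : ∀ {n} (H : Digraph n) (T : Orientation n) → Reflexive H → Consistent H T →
    (u v w : Fin n) → u ⟶[ T ] v → v ⟶[ T ] w → w ⟶[ T ] u →
    (v' w' : Fin n) → v' ⟶[ T ] w' → StarEdge H (v' , w') (v , w) →
    (u ⟶[ T ] v') × (v' ⟶[ T ] w') × (w' ⟶[ T ] u)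
-- Edge (v' , w) → (v , w): the arc u → v' is forced, since v' → u would
-- make the split condition hold along v' → w → u or v' → u → v.
lemma3 H T _ consistent u v w uv vw wu v' .w v'w (edge₁ _ _ v'≢v cond) =
  u→v' , v'w , wu
  where
  open Consistency H T consistent
  u≢v' : u ≢ v'
  u≢v' refl = arc-asym T wu v'w
  u→v' : u ⟶[ T ] v'
  u→v' with total T u v' u≢v'
  ... | inj₁ uv' = uv'
  ... | inj₂ v'u with imp-split H u cond
  ...   | inj₁ c = ⊥-elim (imp-path-absurd (λ v'≡u → u≢v' (sym v'≡u)) c v'w wu)
  ...   | inj₂ c = ⊥-elim (imp-path-absurd v'≢v c v'u uv)
-- Edge (v , w') → (v , w): splitting ImpCond H w v w' at u, the first half
-- is excluded by the triangle, the second propagates w → u to w' → u.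
lemma3 H T _ consistent u v w uv vw wu .v w' vw' (edge₂ _ _ w≢w' cond) =
  uv , vw' , w'→u
  where
  open Consistency H T consistent
  u≢w' : u ≢ w'
  u≢w' refl = arc-asym T uv vw'
  w'→u : w' ⟶[ T ] u
  w'→u with imp-split H u cond
  ... | inj₁ c = ⊥-elim (triangle-no-reversed-imp uv vw wu c)
  ... | inj₂ c = propagate u≢w' w≢w' c wu
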